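{- Let $G$ be a connected quartic plane graph with an independent 2-edge-cut $\{ab,cd\}$. Let $G'$ be the graph obtained from $G$ by deleting the edges $ab$ and $cd$ and adding a new vertex $x$ adjacent to $a,b,c,d$. If $G$ has a 4-locally self-avoiding Eulerian circuit, then so does $G'$.
   Context: All graphs are finite and simple; quartic means 4-regular. A 2-edge-cut is independent if its two edges have no common endpoint. A circuit is a closed trail (no repeated edges), Eulerian if it uses every edge. A subcycle of a circuit $x_1\ldots x_n$ is a subtrail $x_i\ldots x_j$ of consecutive vertices (read cyclically) with $x_i=x_j$ and $x_i,\ldots,x_{j-1}$ distinct; a circuit is 4-locally self-avoiding if it has no subcycle of length at most 4. -}

module Defs where

open import Data.Nat using (ℕ; zero; suc; _+_; _*_; _<_; _≤_; _≤ᵇ_)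
open import Data.Fin using (Fin; zero; suc; toℕ; _≟_)
open import Data.Bool using (Bool; true; false; _∧_; _∨_; not; if_then_else_)
open import Data.List using (List; allFin; upTo; map; concatMap)
open import Data.Bool.ListAction using (and)
open import Data.Nat.ListAction using (sum)
open import Data.Product using (_×_; _,_; ∃; ∃-syntax; proj₁; proj₂)
open import Data.Sum using (_⊎_)
open import Relation.Binary.PropositionalEquality using (_≡_; _≢_)
open import Relation.Nullary using (¬_)
open import Relation.Nullary.Decidable using (⌊_⌋)

Graph : ℕ → Set
Graph n = Fin n → Fin n → Bool

Adj : ∀ {n} → Graph n → Fin n → Fin n → Set
Adj G u v = G u v ≡ true

record IsSimple {n} (G : Graph n) : Set where
  field
    symmetric  : ∀ u v → G u v ≡ G v u
    loopless   : ∀ v → G v v ≡ false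

degree : ∀ {n} → Graph n → Fin n → ℕ
degree {n} G v = sum (map (λ w → if G v w then 1 else 0) (allFin n))

Quartic : ∀ {n} → Graph n → Set
Quartic G = ∀ v → degree G v ≡ 4

data Reach {n} (G : Graph n) : Fin n → Fin n → Set where
  here : ∀ {u} → Reach G u u
  step : ∀ {u w v} → Adj G u w → Reach G w v → Reach G u v

Connected : ∀ {n} → Graph n → Set
Connected G = ∀ u v → Reach G u v

-- Plane graphs, via combinatorial embeddings (rotation systems of genus 0).

iter : ∀ {A : Set} → (A → A) → ℕ → A → A
iter f zero x = x
iter f (suc k) x = f (iter f k x)

-- number of darts (ordered pairs (u,v) with uv an edge) = 2|E|
dartCount : ∀ {n} → Graph n → ℕ
dartCount {n} G =
  sum (concatMap (λ u → map (λ v → if G u v then 1 else 0) (allFin n)) (allFin n))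

faceStep : ∀ {n} → (Fin n → Fin n → Fin n) → Fin n × Fin n → Fin n × Fin n
faceStep rot (u , v) = (v , rot v u)

code : ∀ {n} → Fin n × Fin n → ℕ
code {n} (u , v) = toℕ u * n + toℕ v

-- a dart is the representative of its face if it has the least code in its
-- face orbit (orbits have length at most n*n)
isFaceRep : ∀ {n} → (Fin n → Fin n → Fin n) → Fin n × Fin n → Bool
isFaceRep {n} rot d = and (map (λ k → code d ≤ᵇ code (iter (faceStep rot) k d)) (upTo (n * n)))

faceCount : ∀ {n} → Graph n → (Fin n → Fin n → Fin n) → ℕ
faceCount {n} G rot =
  sum (concatMap (λ u → map (λ v → if G u v ∧ isFaceRep rot (u , v) then 1 else 0)
                            (allFin n)) (allFin n))

-- A plane embedding: a rotation system (cyclic order of neighbours at each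
-- vertex) whose face count satisfies Euler's formula  V - E + F = 2.
record PlaneEmbedding {n} (G : Graph n) : Set where
  field
    rot        : Fin n → Fin n → Fin n
    rot-adj    : ∀ v u → Adj G v u → Adj G v (rot v u)
    rot-cyclic : ∀ v u w → Adj G v u → Adj G v w → ∃[ k ] iter (rot v) k u ≡ w
    euler      : 2 * (n + faceCount G rot) ≡ dartCount G + 4

isPair : ∀ {n} → Fin n → Fin n → Fin n → Fin n → Bool
isPair a b u v = (⌊ u ≟ a ⌋ ∧ ⌊ v ≟ b ⌋) ∨ (⌊ u ≟ b ⌋ ∧ ⌊ v ≟ a ⌋)

deleteTwo : ∀ {n} → Graph n → Fin n → Fin n → Fin n → Fin n → Graph n
deleteTwo G a b c d u v = G u v ∧ not (isPair a b u v ∨ isPair c d u v)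

record IndependentTwoEdgeCut {n} (G : Graph n) (a b c d : Fin n) : Set where
  field
    ab-edge : Adj G a b
    cd-edge : Adj G c d
    a≢c : a ≢ c
    a≢d : a ≢ d
    b≢c : b ≢ c
    b≢d : b ≢ d
    disconnects : ¬ Connected (deleteTwo G a b c d)

-- G' : delete ab, cd and add a new vertex x (= zero) adjacent to a,b,c,d;
-- old vertex w of G becomes suc w.
isABCD : ∀ {n} → Fin n → Fin n → Fin n → Fin n → Fin n → Bool
isABCD a b c d w = ⌊ w ≟ a ⌋ ∨ ⌊ w ≟ b ⌋ ∨ ⌊ w ≟ c ⌋ ∨ ⌊ w ≟ d ⌋

split : ∀ {n} → Graph n → Fin n → Fin n → Fin n → Fin n → Graph (suc n)
split G a b c d zero zero = false
split G a b c d zero (suc w) = isABCD a b c d w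
split G a b c d (suc w) zero = isABCD a b c d w
split G a b c d (suc u) (suc v) = deleteTwo G a b c d u v

-- Eulerian circuits, given as a periodic vertex sequence x₀ x₁ … with
-- period len = |E|; the circuit is x₀ x₁ … x_{len-1} x₀.

Traverses : ∀ {n} → (ℕ → Fin n) → ℕ → Fin n → Fin n → Set
Traverses x i u v = (x i ≡ u × x (suc i) ≡ v) ⊎ (x i ≡ v × x (suc i) ≡ u)

record EulerianCircuit {n} (G : Graph n) : Set where
  field
    len      : ℕ
    walk     : ℕ → Fin n
    periodic : ∀ i → walk (i + len) ≡ walk i
    steps    : ∀ i → i < len → Adj G (walk i) (walk (suc i))
    once     : ∀ u v → Adj G u v →
               ∃[ i ] (i < len × Traverses walk i u v ×
                       (∀ j → j < len → Traverses walk j u v → j ≡ i))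

SubcycleAt : ∀ {n} {G : Graph n} → EulerianCircuit G → ℕ → ℕ → Set
SubcycleAt C i k =
  1 ≤ k × k ≤ len × walk i ≡ walk (i + k) ×
  (∀ p q → p < q → q < k → walk (i + p) ≢ walk (i + q))
  where open EulerianCircuit C

FourLocallySelfAvoiding : ∀ {n} {G : Graph n} → EulerianCircuit G → Set
FourLocallySelfAvoiding C =
  ∀ i k → i < EulerianCircuit.len C → k ≤ 4 → ¬ SubcycleAt C i k

HasLSAEulerianCircuit : ∀ {n} → Graph n → Set
HasLSAEulerianCircuit G = ∃[ C ] FourLocallySelfAvoiding {G = G} C

module Submission where

-- Splitting an independent 2-edge-cut {ab, cd} of a connected quartic graph
-- preserves 4-locally self-avoiding Eulerian circuits.
--
-- An Eulerian circuit of G is first normalised to an infinite walk ω of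
-- period L (`EulerTour`).  The gap lemma (`cut-steps-far`) says that two
-- steps of ω crossing the cut are at least 4 apart: otherwise the short piece
-- of ω between them, together with a fourth edge at its first vertex (G is
-- quartic), would reconnect G - {ab, cd}.  Inserting the new vertex x after
-- every crossing step (`Insertion`) turns u → v into u → x → v and yields an
-- Eulerian circuit of the split graph (`SplitCircuit.circuit`).  Its visits of
-- x are more than 4 steps apart, so a subcycle of length at most 4 passes x at
-- most once, and deleting that visit leaves a subcycle of ω of length at most
-- 4 (`subcycle-transfer`), which does not exist.

open import Defs
open import Data.Nat using (ℕ; zero; suc; _+_; _*_; _∸_; _<_; _≤_; z≤n; s≤s; _%_; _/_; _<?_; NonZero)
open import Data.Nat.Properties hiding (_≟_; suc-injective)
open import Data.Nat.DivMod using (m≡m%n+[m/n]*n; m%n<n; m<n⇒m%n≡m; %-distribˡ-+; [m+kn]%n≡m%n)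
open import Data.Nat.Tactic.RingSolver using (solve-∀)
open import Data.Nat.ListAction using (sum)
open import Data.Fin using (Fin; zero; suc; _≟_)
open import Data.Fin.Properties using (any?; suc-injective)
open import Data.Bool using (Bool; true; false; _∧_; _∨_; if_then_else_)
open import Data.Bool.Properties using (∨-zeroʳ)
open import Data.List using (tabulate)
open import Data.List.Properties using (map-tabulate; tabulate-cong)
open import Data.Product using (_×_; _,_; ∃-syntax; proj₁; proj₂)
open import Data.Sum using (_⊎_; inj₁; inj₂)
open import Data.Empty using (⊥; ⊥-elim)
open import Data.Unit using (⊤; tt)
open import Function using (id; _∘_)
open import Relation.Binary.PropositionalEquality
open import Relation.Binary.Definitions using (tri<; tri≈; tri>)
open import Relation.Nullary using (¬_; Dec; yes; no)
open import Relation.Nullary.Decidable using (⌊_⌋)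

∑ : ∀ {n} → (Fin n → ℕ) → ℕ
∑ f = sum (tabulate f)

∑-mono : ∀ {n} (f g : Fin n → ℕ) → (∀ w → f w ≤ g w) → ∑ f ≤ ∑ g
∑-mono {zero}  f g f≤g = z≤n
∑-mono {suc n} f g f≤g = +-mono-≤ (f≤g zero) (∑-mono (λ w → f (suc w)) (λ w → g (suc w)) (λ w → f≤g (suc w)))

∑-+ : ∀ {n} (f g : Fin n → ℕ) → ∑ (λ w → f w + g w) ≡ ∑ f + ∑ g
∑-+ {zero}  f g = refl
∑-+ {suc n} f g
  rewrite ∑-+ (λ w → f (suc w)) (λ w → g (suc w)) = interchange (f zero) (g zero) _ _
  where
  interchange : ∀ p q r s → (p + q) + (r + s) ≡ (p + r) + (q + s)
  interchange = solve-∀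

∑-zero : ∀ {n} (f : Fin n → ℕ) → (∀ w → f w ≡ 0) → ∑ f ≡ 0
∑-zero {zero}  f f≡0 = refl
∑-zero {suc n} f f≡0 rewrite f≡0 zero = ∑-zero (λ w → f (suc w)) (λ w → f≡0 (suc w))

point : ∀ {n} → Fin n → Fin n → ℕ
point p w = if ⌊ w ≟ p ⌋ then 1 else 0

point-at : ∀ {n} (p : Fin n) → point p p ≡ 1
point-at p with p ≟ p
... | yes _ = refl
... | no p≢p = ⊥-elim (p≢p refl)

point-off : ∀ {n} (p w : Fin n) → w ≢ p → point p w ≡ 0
point-off p w w≢p with w ≟ p
... | yes w≡p = ⊥-elim (w≢p w≡p)
... | no _ = refl

∑-point : ∀ {n} (p : Fin n) → ∑ (point p) ≡ 1
∑-point {suc n} zero =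
  cong₂ _+_ (point-at {suc n} zero) (∑-zero (λ w → point {suc n} zero (suc w)) (λ w → point-off zero (suc w) (λ ())))
∑-point {suc n} (suc p) =
  cong₂ _+_ (point-off (suc p) zero (λ ())) (trans (cong sum (tabulate-cong shift)) (∑-point p))
  where
  shift : ∀ w → point (suc p) (suc w) ≡ point p w
  shift w = by-cases (w ≟ p)
    where
    by-cases : Dec (w ≡ p) → point (suc p) (suc w) ≡ point p w
    by-cases (yes refl) = trans (point-at (suc p)) (sym (point-at p))
    by-cases (no w≢p) = trans (point-off (suc p) (suc w) (λ e → w≢p (suc-injective e)))
                                (sym (point-off p w w≢p))

∑-three : ∀ {n} (f : Fin n → Bool) (p q r : Fin n) →
          (∀ w → f w ≡ true → w ≡ p ⊎ w ≡ q ⊎ w ≡ r) →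
          ∑ (λ w → if f w then 1 else 0) ≤ 3
∑-three f p q r among = begin
  ∑ (λ w → if f w then 1 else 0)            ≤⟨ ∑-mono _ _ bound ⟩
  ∑ (λ w → (point p w + point q w) + point r w)
    ≡⟨ trans (∑-+ _ (point r)) (cong (_+ ∑ (point r)) (∑-+ (point p) (point q))) ⟩
  (∑ (point p) + ∑ (point q)) + ∑ (point r)  ≡⟨ cong₂ _+_ (cong₂ _+_ (∑-point p) (∑-point q)) (∑-point r) ⟩
  3                                          ∎
  where
  open ≤-Reasoning
  bound : ∀ w → (if f w then 1 else 0) ≤ (point p w + point q w) + point r w
  bound w with f w in fw
  ... | false = z≤n
  ... | true with among w fw
  ...   | inj₁ refl = ≤-trans (≤-reflexive (sym (point-at w)))
                       (≤-trans (m≤m+n _ _) (m≤m+n _ _))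
  ...   | inj₂ (inj₁ refl) = ≤-trans (≤-reflexive (sym (point-at w)))
                              (≤-trans (m≤n+m _ (point p w)) (m≤m+n _ _))
  ...   | inj₂ (inj₂ refl) = ≤-trans (≤-reflexive (sym (point-at w))) (m≤n+m _ _)

fourth-neighbour : ∀ {n} (G : Graph n) v → degree G v ≡ 4 → (p q r : Fin n) →
                   ∃[ y ] (Adj G v y × y ≢ p × y ≢ q × y ≢ r)
fourth-neighbour {n} G v deg p q r with any? avoiding?
  where
  avoiding? : ∀ y → Dec (Adj G v y × y ≢ p × y ≢ q × y ≢ r)
  avoiding? y with G v y Data.Bool.≟ true | y ≟ p | y ≟ q | y ≟ r
  ... | no ¬adj | _ | _ | _ = no (λ h → ¬adj (proj₁ h))
  ... | yes _ | yes y≡p | _ | _ = no (λ h → proj₁ (proj₂ h) y≡p)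
  ... | yes _ | no _ | yes y≡q | _ = no (λ h → proj₁ (proj₂ (proj₂ h)) y≡q)
  ... | yes _ | no _ | no _ | yes y≡r = no (λ h → proj₂ (proj₂ (proj₂ h)) y≡r)
  ... | yes adj | no y≢p | no y≢q | no y≢r = yes (adj , y≢p , y≢q , y≢r)
... | yes found = found
... | no none = ⊥-elim (<⇒≱ (s≤s (s≤s (s≤s (s≤s z≤n)))) four≤three)
  where
  among : ∀ w → G v w ≡ true → w ≡ p ⊎ w ≡ q ⊎ w ≡ r
  among w adj with w ≟ p | w ≟ q | w ≟ r
  ... | yes w≡p | _ | _ = inj₁ w≡p
  ... | no _ | yes w≡q | _ = inj₂ (inj₁ w≡q)
  ... | no _ | no _ | yes w≡r = inj₂ (inj₂ w≡r)
  ... | no w≢p | no w≢q | no w≢r = ⊥-elim (none (w , adj , w≢p , w≢q , w≢r))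
  four≤three : 4 ≤ 3
  four≤three = subst (_≤ 3) (trans (cong sum (sym (map-tabulate {n = n} id (λ w → if G v w then 1 else 0)))) deg)
                 (∑-three (G v) p q r among)

-- An `EulerianCircuit` only speaks about
-- positions below its length; we pass to an infinite walk of period
-- L = suc l on which every statement holds at every position, which makes
-- rotating the circuit (`tour-shift`) a matter of reindexing.

module Periodic {n} (ω : ℕ → Fin n) (L : ℕ) .{{_ : NonZero L}}
                (period : ∀ t → ω (t + L) ≡ ω t) where

  repeat : ∀ x q → ω (x + q * L) ≡ ω x
  repeat x zero = cong ω (+-identityʳ x)
  repeat x (suc q) = begin
    ω (x + (L + q * L)) ≡⟨ cong ω (reassoc x L (q * L)) ⟩
    ω (x + q * L + L)   ≡⟨ period (x + q * L) ⟩
    ω (x + q * L)       ≡⟨ repeat x q ⟩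
    ω x                 ∎
    where
    open ≡-Reasoning
    reassoc : ∀ x y z → x + (y + z) ≡ x + z + y
    reassoc = solve-∀

  reduce : ∀ x t → ω (x + t) ≡ ω (x + t % L)
  reduce x t = begin
    ω (x + t)                     ≡⟨ cong (λ z → ω (x + z)) (m≡m%n+[m/n]*n t L) ⟩
    ω (x + (t % L + t / L * L))   ≡⟨ cong ω (sym (+-assoc x (t % L) _)) ⟩
    ω (x + t % L + t / L * L)     ≡⟨ repeat (x + t % L) (t / L) ⟩
    ω (x + t % L)                 ∎
    where open ≡-Reasoning

  reduce-base : ∀ x p → ω (x + p) ≡ ω (x % L + p)
  reduce-base x p =
    trans (cong ω (+-comm x p)) (trans (reduce p x) (cong ω (+-comm p (x % L))))

  traverses-mod : ∀ j {u v} → Traverses ω j u v → Traverses ω (j % L) u v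
  traverses-mod j (inj₁ (e₁ , e₂)) = inj₁ (trans (sym (reduce 0 j)) e₁ , trans (sym (reduce 1 j)) e₂)
  traverses-mod j (inj₂ (e₁ , e₂)) = inj₂ (trans (sym (reduce 0 j)) e₁ , trans (sym (reduce 1 j)) e₂)

record EulerTour {n} (G : Graph n) (ω : ℕ → Fin n) (l : ℕ) : Set where
  field
    period   : ∀ t → ω (t + suc l) ≡ ω t
    adjacent : ∀ t → Adj G (ω t) (ω (suc t))
    covers   : ∀ u v → Adj G u v → ∃[ j ] Traverses ω j u v
    unique   : ∀ j j' u v → Traverses ω j u v → Traverses ω j' u v → j % suc l ≡ j' % suc l

Subcycle : ∀ {n} → (ℕ → Fin n) → ℕ → ℕ → Set
Subcycle ω i k = ω i ≡ ω (i + k) × (∀ p q → p < q → q < k → ω (i + p) ≢ ω (i + q))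

NoShortSubcycle : ∀ {n} → (ℕ → Fin n) → ℕ → Set
NoShortSubcycle ω L = ∀ i k → 1 ≤ k → k ≤ 4 → k ≤ L → ¬ Subcycle ω i k

module _ {n} {G : Graph n} {ω : ℕ → Fin n} {l : ℕ} (tour : EulerTour G ω l) where
  open EulerTour tour
  open Periodic ω (suc l) period

  unique-below : ∀ j j' {u v} → j < suc l → j' < suc l →
                 Traverses ω j u v → Traverses ω j' u v → j ≡ j'
  unique-below j j' j<L j'<L t t' =
    trans (sym (m<n⇒m%n≡m j<L)) (trans (unique j j' _ _ t t') (m<n⇒m%n≡m j'<L))

  tour-shift : (s : ℕ) → EulerTour G (λ t → ω (t + s)) l
  tour-shift s = record
    { period   = λ t → trans (cong ω (swap-last t (suc l) s)) (period (t + s))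
    ; adjacent = λ t → adjacent (t + s)
    ; covers   = λ u v uv → let (j , tj) = covers u v uv in j + s * l , back j tj
    ; unique   = λ j j' u v tj tj' → cancel j j' (unique (j + s) (j' + s) u v tj tj')
    }
    where
    L : ℕ
    L = suc l
    swap-last : ∀ x y z → x + y + z ≡ x + z + y
    swap-last = solve-∀
    s-turns : ∀ j → j + s * l + s ≡ j + s * L
    s-turns j = trans (+-assoc j (s * l) s) (cong (j +_) (trans (+-comm (s * l) s) (sym (*-suc s l))))
    back : ∀ j {u v} → Traverses ω j u v → Traverses (λ t → ω (t + s)) (j + s * l) u v
    back j (inj₁ (e₁ , e₂)) = inj₁ (trans (cong ω (s-turns j)) (trans (repeat j s) e₁) ,
                                    trans (cong ω (s-turns (suc j))) (trans (repeat (suc j) s) e₂))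
    back j (inj₂ (e₁ , e₂)) = inj₂ (trans (cong ω (s-turns j)) (trans (repeat j s) e₁) ,
                                    trans (cong ω (s-turns (suc j))) (trans (repeat (suc j) s) e₂))
    cancel : ∀ j j' → (j + s) % L ≡ (j' + s) % L → j % L ≡ j' % L
    cancel j j' h = trans (sym (undo j)) (trans (cong (λ z → (z + (s * l) % L) % L) h) (undo j'))
      where
      undo : ∀ j → ((j + s) % L + (s * l) % L) % L ≡ j % L
      undo j = begin
        ((j + s) % L + (s * l) % L) % L ≡⟨ sym (%-distribˡ-+ (j + s) (s * l) L) ⟩
        (j + s + s * l) % L             ≡⟨ cong (_% L) (trans (+-assoc j s (s * l)) (cong (j +_) (sym (*-suc s l)))) ⟩
        (j + s * L) % L                 ≡⟨ [m+kn]%n≡m%n j s L ⟩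
        j % L                           ∎
        where open ≡-Reasoning

module FromCircuit {n} {G : Graph n} (simple : IsSimple G) (C : EulerianCircuit G)
                   (l : ℕ) (len≡ : EulerianCircuit.len C ≡ suc l) where
  open EulerianCircuit C

  L : ℕ
  L = suc l

  period′ : ∀ t → walk (t + L) ≡ walk t
  period′ t = subst (λ z → walk (t + z) ≡ walk t) len≡ (periodic t)

  open Periodic walk L period′

  below : ∀ t → t % L < len
  below t = subst (t % L <_) (sym len≡) (m%n<n t L)

  adjacent′ : ∀ t → Adj G (walk t) (walk (suc t))
  adjacent′ t = subst₂ (Adj G) (sym (reduce 0 t)) (sym (reduce 1 t)) (steps (t % L) (below t))

  traversed-edge : ∀ j {u v} → Traverses walk j u v → Adj G u v
  traversed-edge j (inj₁ (refl , refl)) = adjacent′ j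
  traversed-edge j (inj₂ (refl , refl)) = trans (IsSimple.symmetric simple _ _) (adjacent′ j)

  tour : EulerTour G walk l
  tour = record
    { period   = period′
    ; adjacent = adjacent′
    ; covers   = λ u v uv → let (i , _ , ti , _) = once u v uv in i , ti
    ; unique   = λ j j' u v tj tj' →
        let (i , _ , _ , only) = once u v (traversed-edge j tj)
        in trans (only (j % L) (below j) (traverses-mod j tj))
                 (sym (only (j' % L) (below j') (traverses-mod j' tj')))
    }

  no-short-subcycle : FourLocallySelfAvoiding C → NoShortSubcycle walk L
  no-short-subcycle lsa i k 1≤k k≤4 k≤L (closed , distinct) =
    lsa (i % L) k (below i) k≤4
      (1≤k , subst (k ≤_) (sym len≡) k≤L , trans (sym (reduce 0 i)) (trans closed (reduce-base i k)) ,
       λ p q p<q q<k e → distinct p q p<q q<k (trans (reduce-base i p) (trans e (sym (reduce-base i q)))))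

false≢true : false ≢ true
false≢true ()

-- uv and u'v' are the same undirected edge; note that `Traverses x i u v`
-- unfolds to `SameEdge (x i) (x (suc i)) u v`
SameEdge : ∀ {n} → Fin n → Fin n → Fin n → Fin n → Set
SameEdge u v u' v' = (u ≡ u' × v ≡ v') ⊎ (u ≡ v' × v ≡ u')

same-sym : ∀ {n} {u v u' v' : Fin n} → SameEdge u v u' v' → SameEdge u' v' u v
same-sym (inj₁ (refl , refl)) = inj₁ (refl , refl)
same-sym (inj₂ (refl , refl)) = inj₂ (refl , refl)

same-trans : ∀ {n} {u v u' v' u'' v'' : Fin n} →
             SameEdge u v u' v' → SameEdge u' v' u'' v'' → SameEdge u v u'' v''
same-trans (inj₁ (refl , refl)) s = s
same-trans (inj₂ (refl , refl)) (inj₁ (refl , refl)) = inj₂ (refl , refl)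
same-trans (inj₂ (refl , refl)) (inj₂ (refl , refl)) = inj₁ (refl , refl)

isPair-crossed : ∀ {n} (x y u v : Fin n) → ⌊ u ≟ y ⌋ ∧ ⌊ v ≟ x ⌋ ≡ true → u ≡ y × v ≡ x
isPair-crossed x y u v h with u ≟ y | v ≟ x
... | yes e₁ | yes e₂ = e₁ , e₂
... | yes _  | no _   = ⊥-elim (false≢true h)
... | no _   | _      = ⊥-elim (false≢true h)

isPair-sound : ∀ {n} (x y u v : Fin n) → isPair x y u v ≡ true → SameEdge u v x y
isPair-sound x y u v h with u ≟ x | v ≟ y
... | yes e₁ | yes e₂ = inj₁ (e₁ , e₂)
... | yes _  | no _   = inj₂ (isPair-crossed x y u v h)
... | no _   | _      = inj₂ (isPair-crossed x y u v h)

isPair-complete : ∀ {n} (x y u v : Fin n) → SameEdge u v x y → isPair x y u v ≡ true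
isPair-complete x y u v (inj₁ (refl , refl)) with u ≟ u | v ≟ v
... | yes _ | yes _ = refl
... | no u≢u | _ = ⊥-elim (u≢u refl)
... | yes _ | no v≢v = ⊥-elim (v≢v refl)
isPair-complete x y u v (inj₂ (refl , refl)) with u ≟ u | v ≟ v
... | yes _ | yes _ = ∨-zeroʳ _
... | no u≢u | _ = ⊥-elim (u≢u refl)
... | yes _ | no v≢v = ⊥-elim (v≢v refl)

Disjoint : ∀ {n} → Fin n → Fin n → Fin n → Fin n → Set
Disjoint u v u' v' = u ≢ u' × u ≢ v' × v ≢ u' × v ≢ v'

disjoint-sym : ∀ {n} {u v u' v' : Fin n} → Disjoint u v u' v' → Disjoint u' v' u v
disjoint-sym (p , q , r , s) = (λ e → p (sym e)) , (λ e → r (sym e)) , (λ e → q (sym e)) , (λ e → s (sym e))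

disjoint-share : ∀ {n} {u v u' v' w : Fin n} → Disjoint u v u' v' →
                 (u ≡ w ⊎ v ≡ w) → (u' ≡ w ⊎ v' ≡ w) → ⊥
disjoint-share (d₁ , _ , _ , _) (inj₁ refl) (inj₁ refl) = d₁ refl
disjoint-share (_ , d₂ , _ , _) (inj₁ refl) (inj₂ refl) = d₂ refl
disjoint-share (_ , _ , d₃ , _) (inj₂ refl) (inj₁ refl) = d₃ refl
disjoint-share (_ , _ , _ , d₄) (inj₂ refl) (inj₂ refl) = d₄ refl

module CutEdges {n} (a b c d : Fin n) (a≢c : a ≢ c) (a≢d : a ≢ d) (b≢c : b ≢ c) (b≢d : b ≢ d) where

  Cut : Fin n → Fin n → Set
  Cut u v = SameEdge u v a b ⊎ SameEdge u v c d

  isCut : Fin n → Fin n → Bool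
  isCut u v = isPair a b u v ∨ isPair c d u v

  isCut-sound : ∀ u v → isCut u v ≡ true → Cut u v
  isCut-sound u v h with isPair a b u v in ab
  ... | true  = inj₁ (isPair-sound a b u v ab)
  ... | false = inj₂ (isPair-sound c d u v h)

  isCut-complete : ∀ u v → Cut u v → isCut u v ≡ true
  isCut-complete u v (inj₁ s) rewrite isPair-complete a b u v s = refl
  isCut-complete u v (inj₂ s) rewrite isPair-complete c d u v s = ∨-zeroʳ _

  isCut-false : ∀ u v → isCut u v ≡ false → ¬ Cut u v
  isCut-false u v h cut = false≢true (trans (sym h) (isCut-complete u v cut))

  cut-resp : ∀ {u v u' v'} → Cut u v → SameEdge u' v' u v → Cut u' v'
  cut-resp (inj₁ s) s' = inj₁ (same-trans s' s)
  cut-resp (inj₂ s) s' = inj₂ (same-trans s' s)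

  cut-sym : ∀ {u v} → Cut u v → Cut v u
  cut-sym cut = cut-resp cut (inj₂ (refl , refl))

  ab-cd-disjoint : ∀ {u v u' v'} → SameEdge u v a b → SameEdge u' v' c d → Disjoint u v u' v'
  ab-cd-disjoint (inj₁ (refl , refl)) (inj₁ (refl , refl)) = a≢c , a≢d , b≢c , b≢d
  ab-cd-disjoint (inj₁ (refl , refl)) (inj₂ (refl , refl)) = a≢d , a≢c , b≢d , b≢c
  ab-cd-disjoint (inj₂ (refl , refl)) (inj₁ (refl , refl)) = b≢c , b≢d , a≢c , a≢d
  ab-cd-disjoint (inj₂ (refl , refl)) (inj₂ (refl , refl)) = b≢d , b≢c , a≢d , a≢c

  cut-same-or-disjoint : ∀ {u v u' v'} → Cut u v → Cut u' v' →
                         SameEdge u v u' v' ⊎ Disjoint u v u' v'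
  cut-same-or-disjoint (inj₁ s) (inj₁ s') = inj₁ (same-trans s (same-sym s'))
  cut-same-or-disjoint (inj₂ s) (inj₂ s') = inj₁ (same-trans s (same-sym s'))
  cut-same-or-disjoint (inj₁ s) (inj₂ s') = inj₂ (ab-cd-disjoint s s')
  cut-same-or-disjoint (inj₂ s) (inj₁ s') = inj₂ (disjoint-sym (ab-cd-disjoint s' s))

  cut-one-of : ∀ {u v u' v' u'' v''} → Cut u v → Cut u' v' → ¬ SameEdge u v u' v' →
               Cut u'' v'' → SameEdge u'' v'' u v ⊎ SameEdge u'' v'' u' v'
  cut-one-of (inj₁ s) (inj₁ s') different _ = ⊥-elim (different (same-trans s (same-sym s')))
  cut-one-of (inj₂ s) (inj₂ s') different _ = ⊥-elim (different (same-trans s (same-sym s')))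
  cut-one-of (inj₁ s) (inj₂ s') _ (inj₁ t) = inj₁ (same-trans t (same-sym s))
  cut-one-of (inj₁ s) (inj₂ s') _ (inj₂ t) = inj₂ (same-trans t (same-sym s'))
  cut-one-of (inj₂ s) (inj₁ s') _ (inj₁ t) = inj₂ (same-trans t (same-sym s'))
  cut-one-of (inj₂ s) (inj₁ s') _ (inj₂ t) = inj₁ (same-trans t (same-sym s))

  Endpoint : Fin n → Set
  Endpoint w = w ≡ a ⊎ w ≡ b ⊎ w ≡ c ⊎ w ≡ d

  isABCD-complete : ∀ w → Endpoint w → isABCD a b c d w ≡ true
  isABCD-complete w endpoint with w ≟ a | w ≟ b | w ≟ c | w ≟ d
  ... | yes _ | _ | _ | _ = refl
  ... | no _ | yes _ | _ | _ = refl
  ... | no _ | no _ | yes _ | _ = refl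
  ... | no _ | no _ | no _ | yes _ = refl
  ... | no w≢a | no w≢b | no w≢c | no w≢d with endpoint
  ...   | inj₁ w≡a = ⊥-elim (w≢a w≡a)
  ...   | inj₂ (inj₁ w≡b) = ⊥-elim (w≢b w≡b)
  ...   | inj₂ (inj₂ (inj₁ w≡c)) = ⊥-elim (w≢c w≡c)
  ...   | inj₂ (inj₂ (inj₂ w≡d)) = ⊥-elim (w≢d w≡d)

  isABCD-sound : ∀ w → isABCD a b c d w ≡ true → Endpoint w
  isABCD-sound w h with w ≟ a | w ≟ b | w ≟ c | w ≟ d
  ... | yes w≡a | _ | _ | _ = inj₁ w≡a
  ... | no _ | yes w≡b | _ | _ = inj₂ (inj₁ w≡b)
  ... | no _ | no _ | yes w≡c | _ = inj₂ (inj₂ (inj₁ w≡c))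
  ... | no _ | no _ | no _ | yes w≡d = inj₂ (inj₂ (inj₂ w≡d))
  ... | no _ | no _ | no _ | no _ = ⊥-elim (false≢true h)

  cut-endpoint : ∀ {u v} → Cut u v → Endpoint u
  cut-endpoint (inj₁ (inj₁ (refl , _))) = inj₁ refl
  cut-endpoint (inj₁ (inj₂ (refl , _))) = inj₂ (inj₁ refl)
  cut-endpoint (inj₂ (inj₁ (refl , _))) = inj₂ (inj₂ (inj₁ refl))
  cut-endpoint (inj₂ (inj₂ (refl , _))) = inj₂ (inj₂ (inj₂ refl))

  endpoint-cut : ∀ {w} → Endpoint w → ∃[ p ] Cut w p
  endpoint-cut (inj₁ refl) = b , inj₁ (inj₁ (refl , refl))
  endpoint-cut (inj₂ (inj₁ refl)) = a , inj₁ (inj₂ (refl , refl))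
  endpoint-cut (inj₂ (inj₂ (inj₁ refl))) = d , inj₂ (inj₁ (refl , refl))
  endpoint-cut (inj₂ (inj₂ (inj₂ refl))) = c , inj₂ (inj₂ (refl , refl))

reach-snoc : ∀ {n} {H : Graph n} {u v w} → Reach H u v → Adj H v w → Reach H u w
reach-snoc here vw = step vw here
reach-snoc (step uu' r) vw = step uu' (reach-snoc r vw)

reach-++ : ∀ {n} {H : Graph n} {u v w} → Reach H u v → Reach H v w → Reach H u w
reach-++ here r = r
reach-++ (step uu' r) r' = step uu' (reach-++ r r')

reach-sym : ∀ {n} {H : Graph n} → (∀ u v → Adj H u v → Adj H v u) →
            ∀ {u v} → Reach H u v → Reach H v u
reach-sym H-sym here = here
reach-sym H-sym (step uu' r) = reach-snoc (reach-sym H-sym r) (H-sym _ _ uu')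

reach-along : ∀ {n} {H : Graph n} (x : ℕ → Fin n) {i} j → i ≤ j →
              (∀ t → i ≤ t → t < j → Adj H (x t) (x (suc t))) → Reach H (x i) (x j)
reach-along x zero z≤n _ = here
reach-along x (suc j) i≤1+j steps with m≤n⇒m<n∨m≡n i≤1+j
... | inj₂ refl = here
... | inj₁ (s≤s i≤j) =
  reach-snoc (reach-along x j i≤j (λ t i≤t t<j → steps t i≤t (m<n⇒m<1+n t<j))) (steps j i≤j ≤-refl)

no-loop : ∀ {n} {G : Graph n} → IsSimple G → ∀ {x y} → Adj G x y → x ≢ y
no-loop simple {x} xx refl = false≢true (trans (sym (IsSimple.loopless simple x)) xx)

-- In a connected quartic graph with a 2-edge-cut {ab, cd},
-- an Eulerian circuit cannot traverse the two cut edges within fewer than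
-- 4 steps of each other: the piece of the circuit between them, together
-- with a fourth edge at its first vertex, would reconnect G - {ab, cd}.
module TwoEdgeCut {n} {G : Graph n} (simple : IsSimple G) (quartic : Quartic G) (connected : Connected G)
                  (a b c d : Fin n) (a≢c : a ≢ c) (a≢d : a ≢ d) (b≢c : b ≢ c) (b≢d : b ≢ d)
                  (disconnects : ¬ Connected (deleteTwo G a b c d)) where
  open CutEdges a b c d a≢c a≢d b≢c b≢d public

  H : Graph n
  H = deleteTwo G a b c d

  H-intro : ∀ {u v} → Adj G u v → ¬ Cut u v → Adj H u v
  H-intro {u} {v} uv ¬cut with G u v | isCut u v in cut?
  ... | true  | false = refl
  ... | true  | true  = ⊥-elim (¬cut (isCut-sound u v cut?))
  H-intro {u} {v} () ¬cut | false | _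

  H-elim : ∀ {u v} → Adj H u v → Adj G u v × ¬ Cut u v
  H-elim {u} {v} uv with G u v | isCut u v in cut?
  ... | true  | false = refl , isCut-false u v cut?
  H-elim {u} {v} () | true  | true
  H-elim {u} {v} () | false | _

  H-sym : ∀ u v → Adj H u v → Adj H v u
  H-sym u v uv = let (uv-in-G , ¬cut) = H-elim uv in
    H-intro (trans (IsSimple.symmetric simple v u) uv-in-G) (λ cut → ¬cut (cut-sym cut))

  cut-separates : (∀ u v → Cut u v → Reach H u v) → ⊥
  cut-separates joined = disconnects (λ u v → lift (connected u v))
    where
    lift : ∀ {u v} → Reach G u v → Reach H u v
    lift here = here
    lift {u} (step {w = w} uw r) with isCut u w in cut?
    ... | false = step (H-intro uw (isCut-false u w cut?)) (lift r)
    ... | true  = reach-++ (joined u w (isCut-sound u w cut?)) (lift r)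

  -- A tour crossing the cut at steps 0 and m, with 1 ≤ m ≤ 3, is impossible:
  -- every endpoint of a cut edge is joined in H to ω (suc m).
  module CloseCuts {ω : ℕ → Fin n} {l : ℕ} (tour : EulerTour G ω l)
                   (m : ℕ) (1≤m : 1 ≤ m) (m≤3 : m ≤ 3) (m<L : m < suc l)
                   (cut₀ : Cut (ω 0) (ω 1)) (cutₘ : Cut (ω m) (ω (suc m))) where
    open EulerTour tour

    L : ℕ
    L = suc l

    0<L : 0 < L
    0<L = s≤s z≤n

    different : ¬ SameEdge (ω 0) (ω 1) (ω m) (ω (suc m))
    different s = <⇒≢ 1≤m (unique-below tour 0 m 0<L m<L s (inj₁ (refl , refl)))

    disjoint : Disjoint (ω 0) (ω 1) (ω m) (ω (suc m))
    disjoint with cut-same-or-disjoint cut₀ cutₘ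
    ... | inj₁ s = ⊥-elim (different s)
    ... | inj₂ disj = disj

    uncut : ∀ t → t < L → t ≢ 0 → t ≢ m → Adj H (ω t) (ω (suc t))
    uncut t t<L t≢0 t≢m = H-intro (adjacent t) ¬cut
      where
      ¬cut : ¬ Cut (ω t) (ω (suc t))
      ¬cut cutₜ with cut-one-of cut₀ cutₘ different cutₜ
      ... | inj₁ s = t≢0 (unique-below tour t 0 t<L 0<L s (inj₁ (refl , refl)))
      ... | inj₂ s = t≢m (unique-below tour t m t<L m<L s (inj₁ (refl , refl)))

    short : Reach H (ω 1) (ω m)
    short = reach-along ω m 1≤m (λ t 1≤t t<m →
      uncut t (<-trans t<m m<L) (λ t≡0 → <⇒≢ 1≤t (sym t≡0)) (<⇒≢ t<m))

    long : ∀ t → suc m ≤ t → t ≤ L → Reach H (ω (suc m)) (ω t)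
    long t m<t t≤L = reach-along ω t m<t (λ u m<u u<t →
      uncut u (<-≤-trans u<t t≤L) (λ u≡0 → <⇒≢ (<-≤-trans (s≤s z≤n) m<u) (sym u≡0))
            (λ u≡m → <⇒≢ m<u (sym u≡m)))

    -- ω 1 has a neighbour y ∉ {ω 0, ω 2}; the edge (ω 1) y is not cut and
    -- is traversed after step m, hence ω 1 is joined to ω (suc m)
    fourth : ∃[ y ] (Adj G (ω 1) y × y ≢ ω 0 × y ≢ ω 2 × y ≢ ω 2)
    fourth = fourth-neighbour G (ω 1) (quartic (ω 1)) (ω 0) (ω 2) (ω 2)

    y : Fin n
    y = proj₁ fourth

    adj-y : Adj G (ω 1) y
    adj-y = proj₁ (proj₂ fourth)

    y≢ω0 : y ≢ ω 0
    y≢ω0 = proj₁ (proj₂ (proj₂ fourth))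

    y≢ω2 : y ≢ ω 2
    y≢ω2 = proj₁ (proj₂ (proj₂ (proj₂ fourth)))

    y-uncut : ¬ Cut (ω 1) y
    y-uncut cut-y with cut-same-or-disjoint cut-y cut₀
    ... | inj₁ (inj₁ (ω1≡ω0 , _)) = no-loop simple (adjacent 0) (sym ω1≡ω0)
    ... | inj₁ (inj₂ (_ , y≡ω0)) = y≢ω0 y≡ω0
    ... | inj₂ (_ , ω1≢ω1 , _) = ω1≢ω1 refl

    r : ℕ
    r = proj₁ (covers (ω 1) y adj-y) % L

    r<L : r < L
    r<L = m%n<n (proj₁ (covers (ω 1) y adj-y)) L
    r-traverses : Traverses ω r (ω 1) y
    r-traverses = traverses-mod (proj₁ (covers (ω 1) y adj-y)) (proj₂ (covers (ω 1) y adj-y))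
      where open Periodic ω L period

    not-early : ∀ t → Traverses ω t (ω 1) y → t ≤ m → ⊥
    not-early 0 (inj₁ (ω0≡ω1 , _)) _ = no-loop simple (adjacent 0) ω0≡ω1
    not-early 0 (inj₂ (ω0≡y , _)) _ = y≢ω0 (sym ω0≡y)
    not-early 1 (inj₁ (_ , ω2≡y)) _ = y≢ω2 (sym ω2≡y)
    not-early 1 (inj₂ (_ , ω2≡ω1)) _ = no-loop simple (adjacent 1) (sym ω2≡ω1)
    not-early t@(suc (suc t')) tr t≤m with t Data.Nat.≟ m
    ... | yes refl = y-uncut (cut-resp cutₘ (same-sym tr))
    ... | no t≢m = third t' tr (≤∧≢⇒< t≤m t≢m)
      where
      third : ∀ t' → Traverses ω (suc (suc t')) (ω 1) y → suc (suc t') < m → ⊥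
      third 0 (inj₁ (ω2≡ω1 , _)) _ = no-loop simple (adjacent 1) (sym ω2≡ω1)
      third 0 (inj₂ (_ , ω3≡ω1)) 2<m =
        proj₁ (proj₂ (proj₂ disjoint)) (trans (sym ω3≡ω1) (cong ω (sym (≤-antisym m≤3 2<m))))
      third (suc t') _ t<m = <⇒≱ t<m (≤-trans m≤3 (s≤s (s≤s (s≤s z≤n))))

    r-late : suc m ≤ r
    r-late with suc m ≤? r
    ... | yes m<r = m<r
    ... | no r≤m = ⊥-elim (not-early r r-traverses (≤-pred (≰⇒> r≤m)))

    to-ω1 : Reach H (ω (suc m)) (ω 1)
    to-ω1 with r-traverses
    ... | inj₁ (ωr≡ω1 , _) = subst (Reach H (ω (suc m))) ωr≡ω1 (long r r-late (<⇒≤ r<L))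
    ... | inj₂ (_ , ωr+1≡ω1) = subst (Reach H (ω (suc m))) ωr+1≡ω1 (long (suc r) (m≤n⇒m≤1+n r-late) r<L)

    to-ω0 : Reach H (ω (suc m)) (ω 0)
    to-ω0 = subst (Reach H (ω (suc m))) (period 0) (long L m<L ≤-refl)

    from-centre : ∀ {u} → u ≡ ω 0 ⊎ u ≡ ω 1 ⊎ u ≡ ω m ⊎ u ≡ ω (suc m) → Reach H (ω (suc m)) u
    from-centre (inj₁ refl) = to-ω0
    from-centre (inj₂ (inj₁ refl)) = to-ω1
    from-centre (inj₂ (inj₂ (inj₁ refl))) = reach-++ to-ω1 short
    from-centre (inj₂ (inj₂ (inj₂ refl))) = here

    via-centre : ∀ {u v} → (u ≡ ω 0 ⊎ u ≡ ω 1 ⊎ u ≡ ω m ⊎ u ≡ ω (suc m)) →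
                 (v ≡ ω 0 ⊎ v ≡ ω 1 ⊎ v ≡ ω m ⊎ v ≡ ω (suc m)) → Reach H u v
    via-centre eu ev = reach-++ (reach-sym H-sym (from-centre eu)) (from-centre ev)

    joined : ∀ u v → Cut u v → Reach H u v
    joined u v cut with cut-one-of cut₀ cutₘ different cut
    ... | inj₁ (inj₁ (e₁ , e₂)) = via-centre (inj₁ e₁) (inj₂ (inj₁ e₂))
    ... | inj₁ (inj₂ (e₁ , e₂)) = via-centre (inj₂ (inj₁ e₁)) (inj₁ e₂)
    ... | inj₂ (inj₁ (e₁ , e₂)) = via-centre (inj₂ (inj₂ (inj₁ e₁))) (inj₂ (inj₂ (inj₂ e₂)))
    ... | inj₂ (inj₂ (e₁ , e₂)) = via-centre (inj₂ (inj₂ (inj₂ e₁))) (inj₂ (inj₂ (inj₁ e₂)))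

    impossible : ⊥
    impossible = cut-separates joined

  cut-steps-far : ∀ {ω : ℕ → Fin n} {l : ℕ} (tour : EulerTour G ω l) s m → 1 ≤ m → m < suc l →
                  Cut (ω s) (ω (suc s)) → Cut (ω (s + m)) (ω (suc (s + m))) → 4 ≤ m
  cut-steps-far {ω} tour s m 1≤m m<L cutₛ cutₛ₊ₘ with m ≤? 3
  ... | no m≰3 = ≰⇒> m≰3
  ... | yes m≤3 = ⊥-elim (CloseCuts.impossible (tour-shift tour s) m 1≤m m≤3 m<L cutₛ
                            (subst (λ k → Cut (ω k) (ω (suc k))) (+-comm s m) cutₛ₊ₘ))

-- Given a Boolean marking of the
-- steps s → s+1 of a walk, the expanded walk visits, in order, every
-- original position s and, right after each marked s, one extra vertex.
-- Its positions are described by states (s , at) and (s , after); the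
-- state at time t is computed by iteration, and `position` inverts it.
data Phase : Set where
  at after : Phase

module Insertion (marked : ℕ → Bool) where

  State : Set
  State = ℕ × Phase

  next : State → State
  next (s , at)    = if marked s then (s , after) else (suc s , at)
  next (s , after) = (suc s , at)

  state : ℕ → State
  state t = iter next t (0 , at)

  marks : ℕ → ℕ
  marks zero    = 0
  marks (suc s) = if marked s then suc (marks s) else marks s

  position : State → ℕ
  position (s , at)    = s + marks s
  position (s , after) = suc (s + marks s)

  -- a reachable state: the extra vertex only follows marked steps
  Valid : State → Set
  Valid (s , at)    = ⊤
  Valid (s , after) = marked s ≡ true

  next-marked : ∀ s → marked s ≡ true → next (s , at) ≡ (s , after)
  next-marked s m rewrite m = refl

  next-unmarked : ∀ s → marked s ≡ false → next (s , at) ≡ (suc s , at)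
  next-unmarked s m rewrite m = refl

  marks-marked : ∀ s → marked s ≡ true → marks (suc s) ≡ suc (marks s)
  marks-marked s m rewrite m = refl

  marks-unmarked : ∀ s → marked s ≡ false → marks (suc s) ≡ marks s
  marks-unmarked s m rewrite m = refl

  next-position : ∀ x → Valid x → position (next x) ≡ suc (position x) × Valid (next x)
  next-position (s , after) m =
    trans (cong (λ k → suc (s + k)) (marks-marked s m)) (cong suc (+-suc s (marks s))) , tt
  next-position (s , at) _ with marked s in m
  ... | true  = refl , m
  ... | false = cong (λ k → suc (s + k)) (marks-unmarked s m) , tt

  position-state : ∀ t → position (state t) ≡ t × Valid (state t)
  position-state zero = refl , tt
  position-state (suc t) =
    let (p , v) = position-state t ; (p' , v') = next-position (state t) v
    in trans p' (cong suc p) , v'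

  state-at : ∀ s → state (s + marks s) ≡ (s , at)
  state-at zero = refl
  state-at (suc s) with marked s in m
  ... | false = trans (cong next (state-at s)) (next-unmarked s m)
  ... | true  = trans (cong state (cong suc (+-suc s (marks s))))
                      (trans (cong (λ x → next (next x)) (state-at s)) (cong next (next-marked s m)))

  state-position : ∀ x → Valid x → state (position x) ≡ x
  state-position (s , at) _ = state-at s
  state-position (s , after) m = trans (cong next (state-at s)) (next-marked s m)

  time : ∀ {t x} → state t ≡ x → t ≡ position x
  time {t} e = trans (sym (proj₁ (position-state t))) (cong position e)

  marks-mono : ∀ {s s'} → s ≤ s' → marks s ≤ marks s'
  marks-mono {s} {s'} s≤s' = subst (λ z → marks s ≤ marks z) (m∸n+n≡m s≤s') (grow (s' ∸ s))
    where
    grow : ∀ d → marks s ≤ marks (d + s)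
    grow zero = ≤-refl
    grow (suc d) with marked (d + s) in m
    ... | true  = m≤n⇒m≤1+n (grow d)
    ... | false = grow d

  data StepView (t : ℕ) : Set where
    kept  : ∀ s → state t ≡ (s , at) → state (suc t) ≡ (suc s , at) → marked s ≡ false → StepView t
    enter : ∀ s → state t ≡ (s , at) → state (suc t) ≡ (s , after) → marked s ≡ true → StepView t
    exit  : ∀ s → state t ≡ (s , after) → state (suc t) ≡ (suc s , at) → marked s ≡ true → StepView t

  step-view : ∀ t → StepView t
  step-view t with state t in e | proj₂ (position-state t)
  ... | (s , after) | m = exit s e (cong next e) m
  ... | (s , at) | _ with marked s in m
  ...   | true  = enter s e (trans (cong next e) (next-marked s m)) m
  ...   | false = kept s e (trans (cong next e) (next-unmarked s m)) m

  advance : ∀ t s d → state t ≡ (s , at) →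
            (∀ q → 1 ≤ q → q ≤ d → proj₂ (state (t + q)) ≡ at) → state (t + d) ≡ (s + d , at)
  advance t s zero e _ = trans (cong state (+-identityʳ t)) (trans e (cong (_, at) (sym (+-identityʳ s))))
  advance t s (suc d) e stays with marked (s + d) in m
  ... | true  = ⊥-elim (after≢at (trans (cong proj₂ (sym reached)) (stays (suc d) (s≤s z≤n) ≤-refl)))
    where
    after≢at : after ≢ at
    after≢at ()
    reached : state (t + suc d) ≡ (s + d , after)
    reached = trans (cong state (+-suc t d))
                (trans (cong next (advance t s d e (λ q 1≤q q≤d → stays q 1≤q (m≤n⇒m≤1+n q≤d))))
                       (next-marked (s + d) m))
  ... | false = trans (cong state (+-suc t d))
                  (trans (cong next (advance t s d e (λ q 1≤q q≤d → stays q 1≤q (m≤n⇒m≤1+n q≤d))))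
                         (trans (next-unmarked (s + d) m) (cong (_, at) (sym (+-suc s d)))))

  -- One period.  If the marking has period L, the expanded walk has period
  -- L + marks L, and the states of one expanded period are those with s < L.
  module OnePeriod (L : ℕ) (marked-periodic : ∀ s → marked (s + L) ≡ marked s) where
    P : ℕ
    P = L + marks L

    shift : State → State
    shift (s , ph) = (s + L , ph)

    next-shift : ∀ x → next (shift x) ≡ shift (next x)
    next-shift (s , after) = refl
    next-shift (s , at) rewrite marked-periodic s with marked s
    ... | true  = refl
    ... | false = refl

    iter-shift : ∀ t x → iter next t (shift x) ≡ shift (iter next t x)
    iter-shift zero x = refl
    iter-shift (suc t) x = trans (cong next (iter-shift t x)) (next-shift (iter next t x))

    iter-+ : ∀ t u x → iter next (t + u) x ≡ iter next t (iter next u x)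
    iter-+ zero u x = refl
    iter-+ (suc t) u x = cong next (iter-+ t u x)

    state-periodic : ∀ t → state (t + P) ≡ shift (state t)
    state-periodic t = trans (iter-+ t P (0 , at)) (trans (cong (iter next t) (state-at L)) (iter-shift t (0 , at)))

    within : ∀ x → position x < P → proj₁ x < L
    within (s , ph) x<P with s <? L
    ... | yes s<L = s<L
    ... | no s≮L = ⊥-elim (<-irrefl refl (≤-trans x<P (late ph)))
      where
      L≤s : L ≤ s
      L≤s = ≮⇒≥ s≮L
      late : ∀ ph → P ≤ position (s , ph)
      late at    = +-mono-≤ L≤s (marks-mono L≤s)
      late after = m≤n⇒m≤1+n (late at)

    at-within : ∀ s → s < L → position (s , at) < P
    at-within s s<L = +-mono-<-≤ s<L (marks-mono (<⇒≤ s<L))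

    after-within : ∀ s → s < L → marked s ≡ true → position (s , after) < P
    after-within s s<L m = begin-strict
      suc (s + marks s) ≡⟨ sym (+-suc s (marks s)) ⟩
      s + suc (marks s) ≤⟨ +-monoʳ-≤ s (subst (_≤ marks L) (marks-marked s m) (marks-mono s<L)) ⟩
      s + marks L       <⟨ +-monoˡ-< (marks L) s<L ⟩
      P                 ∎
      where open ≤-Reasoning

skip : ℕ → ℕ → ℕ
skip p r with r <? p
... | yes _ = r
... | no _  = suc r

skip-below : ∀ {p r} → r < p → skip p r ≡ r
skip-below {p} {r} r<p with r <? p
... | yes _ = refl
... | no r≮p = ⊥-elim (r≮p r<p)

skip-above : ∀ {p r} → ¬ r < p → skip p r ≡ suc r
skip-above {p} {r} r≮p with r <? p
... | yes r<p = ⊥-elim (r≮p r<p)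
... | no _ = refl

skip-mono : ∀ p r r' → r < r' → skip p r < skip p r'
skip-mono p r r' r<r' with r <? p | r' <? p
... | yes _ | yes _ = r<r'
... | yes _ | no _ = m<n⇒m<1+n r<r'
... | no r≮p | yes r'<p = ⊥-elim (r≮p (<-trans r<r' r'<p))
... | no _ | no _ = s≤s r<r'

subcycle-transfer : ∀ {n} (x : ℕ → Fin (suc n)) (ω : ℕ → Fin n) (g : ℕ → ℕ) i s k k' →
                    (∀ r r' → r < r' → g r < g r') → g 0 ≡ 0 → g k' ≡ k →
                    (∀ r → r ≤ k' → x (i + g r) ≡ suc (ω (s + r))) →
                    Subcycle x i k → Subcycle ω s k'
subcycle-transfer x ω g i s k k' mono g0 gk' read (closed , distinct) = closed′ , distinct′
  where
  open ≡-Reasoning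
  closed′ : ω s ≡ ω (s + k')
  closed′ = suc-injective (begin
    suc (ω s)            ≡⟨ cong (suc ∘ ω) (sym (+-identityʳ s)) ⟩
    suc (ω (s + 0))      ≡⟨ sym (read 0 z≤n) ⟩
    x (i + g 0)          ≡⟨ cong (λ z → x (i + z)) g0 ⟩
    x (i + 0)            ≡⟨ cong x (+-identityʳ i) ⟩
    x i                  ≡⟨ closed ⟩
    x (i + k)            ≡⟨ cong (λ z → x (i + z)) (sym gk') ⟩
    x (i + g k')         ≡⟨ read k' ≤-refl ⟩
    suc (ω (s + k'))     ∎)
  distinct′ : ∀ p q → p < q → q < k' → ω (s + p) ≢ ω (s + q)
  distinct′ p q p<q q<k' e =
    distinct (g p) (g q) (mono p q p<q) (subst (g q <_) gk' (mono q k' q<k'))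
      (trans (read p (<⇒≤ (<-trans p<q q<k'))) (trans (cong suc e) (sym (read q (<⇒≤ q<k')))))

exactly-once : (P : ℕ) (T : ℕ → Set) → (∃[ i ] (i < P × T i)) →
               (∀ j j' → j < P → j' < P → T j → T j' → j ≡ j') →
               ∃[ i ] (i < P × T i × (∀ j → j < P → T j → j ≡ i))
exactly-once P T (i , i<P , Ti) agree = i , i<P , Ti , λ j j<P Tj → agree j i j<P i<P Tj Ti

traverses-swap : ∀ {n} {x : ℕ → Fin n} {i u v} → Traverses x i u v → Traverses x i v u
traverses-swap (inj₁ (e₁ , e₂)) = inj₂ (e₁ , e₂)
traverses-swap (inj₂ (e₁ , e₂)) = inj₁ (e₁ , e₂)

module SplitCircuit {n} {G : Graph n} (simple : IsSimple G) (quartic : Quartic G) (connected : Connected G)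
                    {a b c d : Fin n} (cut : IndependentTwoEdgeCut G a b c d)
                    {ω : ℕ → Fin n} {l : ℕ} (tour : EulerTour G ω l) where
  open IndependentTwoEdgeCut cut
  open TwoEdgeCut simple quartic connected a b c d a≢c a≢d b≢c b≢d disconnects
  open EulerTour tour
  open Periodic ω (suc l) period using (traverses-mod)

  L : ℕ
  L = suc l

  crossing : ℕ → Bool
  crossing s = isCut (ω s) (ω (suc s))

  open Insertion crossing public
  open OnePeriod L (λ s → cong₂ isCut (period s) (period (suc s))) public

  crossing-sound : ∀ s → crossing s ≡ true → Cut (ω s) (ω (suc s))
  crossing-sound s = isCut-sound (ω s) (ω (suc s))

  cut-adjacent : ∀ {u v} → Cut u v → Adj G u v
  cut-adjacent (inj₁ (inj₁ (refl , refl))) = ab-edge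
  cut-adjacent (inj₁ (inj₂ (refl , refl))) = trans (IsSimple.symmetric simple _ _) ab-edge
  cut-adjacent (inj₂ (inj₁ (refl , refl))) = cd-edge
  cut-adjacent (inj₂ (inj₂ (refl , refl))) = trans (IsSimple.symmetric simple _ _) cd-edge

  first-traversal : ∀ u v → Adj G u v → ∃[ i ] (i < L × Traverses ω i u v)
  first-traversal u v uv = let (j , tj) = covers u v uv in j % L , m%n<n j L , traverses-mod j tj

  crossings-far : ∀ s s' → s < s' → s' ∸ s < L → crossing s ≡ true → crossing s' ≡ true → 4 ≤ s' ∸ s
  crossings-far s s' s<s' gap<L cs cs' =
    cut-steps-far tour s (s' ∸ s) (m<n⇒0<n∸m s<s') gap<L (crossing-sound s cs)
      (subst (λ k → Cut (ω k) (ω (suc k))) (sym (m+[n∸m]≡n (<⇒≤ s<s'))) (crossing-sound s' cs'))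

  crossed-twice : ∀ s s' → s < s' → s' < L → Cut (ω s) (ω (suc s)) → Cut (ω s') (ω (suc s')) → 4 ≤ L
  crossed-twice s s' s<s' s'<L cs cs' =
    ≤-trans (crossings-far s s' s<s' (≤-<-trans (m∸n≤m s' s) s'<L) (isCut-complete _ _ cs) (isCut-complete _ _ cs'))
            (≤-trans (m∸n≤m s' s) (<⇒≤ s'<L))

  -- ab and cd are crossed at different steps of the first period
  period-≥4 : 4 ≤ L
  period-≥4 with first-traversal a b ab-edge | first-traversal c d cd-edge
  ... | i , i<L , tab | i' , i'<L , tcd with <-cmp i i'
  ...   | tri< i<i' _ _ = crossed-twice i i' i<i' i'<L (inj₁ tab) (inj₂ tcd)
  ...   | tri> _ _ i'<i = crossed-twice i' i i'<i i<L (inj₂ tcd) (inj₁ tab)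
  ...   | tri≈ _ refl _ with same-trans (same-sym tab) tcd
  ...     | inj₁ (a≡c , _) = ⊥-elim (a≢c a≡c)
  ...     | inj₂ (a≡d , _) = ⊥-elim (a≢d a≡d)

  vertex : State → Fin (suc n)
  vertex (s , at)    = suc (ω s)
  vertex (s , after) = zero

  W : ℕ → Fin (suc n)
  W t = vertex (state t)

  Split : Graph (suc n)
  Split = split G a b c d

  W-periodic : ∀ t → W (t + P) ≡ W t
  W-periodic t = trans (cong vertex (state-periodic t)) (unshift (state t))
    where
    unshift : ∀ x → vertex (shift x) ≡ vertex x
    unshift (s , at)    = cong suc (period s)
    unshift (s , after) = refl

  x-adjacent : ∀ {u v} → Cut u v → Adj Split zero (suc u)
  x-adjacent cutᵤᵥ = isABCD-complete _ (cut-endpoint cutᵤᵥ)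

  W-step : ∀ t → Adj Split (W t) (W (suc t))
  W-step t with step-view t
  ... | kept s e e' m = subst₂ (Adj Split) (cong vertex (sym e)) (cong vertex (sym e'))
                          (H-intro (adjacent s) (isCut-false _ _ m))
  ... | enter s e e' m = subst₂ (Adj Split) (cong vertex (sym e)) (cong vertex (sym e'))
                           (x-adjacent (crossing-sound s m))
  ... | exit s e e' m = subst₂ (Adj Split) (cong vertex (sym e)) (cong vertex (sym e'))
                          (x-adjacent (cut-sym (crossing-sound s m)))

  suc≢zero : ∀ {w : Fin n} → _≡_ {A = Fin (suc n)} (suc w) zero → ⊥
  suc≢zero ()

  kept-step : ∀ j {u v} → j < P → Traverses W j (suc u) (suc v) →
              ∃[ s ] (s < L × state j ≡ (s , at) × Traverses ω s u v)
  kept-step j j<P tr with step-view j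
  ... | kept s e e' _ = s , within (s , at) (subst (_< P) (time e) j<P) , e , lower tr
    where
    lower : ∀ {u v} → Traverses W j (suc u) (suc v) → Traverses ω s u v
    lower (inj₁ (e₁ , e₂)) = inj₁ (suc-injective (trans (cong vertex (sym e)) e₁) ,
                                   suc-injective (trans (cong vertex (sym e')) e₂))
    lower (inj₂ (e₁ , e₂)) = inj₂ (suc-injective (trans (cong vertex (sym e)) e₁) ,
                                   suc-injective (trans (cong vertex (sym e')) e₂))
  ... | enter s e e' _ with tr
  ...   | inj₁ (_ , e₂) = ⊥-elim (suc≢zero (trans (sym e₂) (cong vertex e')))
  ...   | inj₂ (_ , e₂) = ⊥-elim (suc≢zero (trans (sym e₂) (cong vertex e')))
  kept-step j j<P tr | exit s e e' _ with tr
  ...   | inj₁ (e₁ , _) = ⊥-elim (suc≢zero (trans (sym e₁) (cong vertex e)))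
  ...   | inj₂ (e₁ , _) = ⊥-elim (suc≢zero (trans (sym e₁) (cong vertex e)))

  once-kept : ∀ u v → Adj H u v →
              ∃[ i ] (i < P × Traverses W i (suc u) (suc v) × (∀ j → j < P → Traverses W j (suc u) (suc v) → j ≡ i))
  once-kept u v uv = exactly-once P (λ j → Traverses W j (suc u) (suc v)) present agree
    where
    uncut : ¬ Cut u v
    uncut = proj₂ (H-elim uv)

    traversal : ∃[ i ] (i < L × Traverses ω i u v)
    traversal = first-traversal u v (proj₁ (H-elim uv))

    i : ℕ
    i = proj₁ traversal

    i<L : i < L
    i<L = proj₁ (proj₂ traversal)

    tr : Traverses ω i u v
    tr = proj₂ (proj₂ traversal)

    unmarked : crossing i ≡ false
    unmarked with crossing i in m
    ... | false = refl
    ... | true  = ⊥-elim (uncut (cut-resp (crossing-sound i m) (same-sym tr)))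

    present : ∃[ t ] (t < P × Traverses W t (suc u) (suc v))
    present = position (i , at) , at-within i i<L , lift tr
      where
      lift : Traverses ω i u v → Traverses W (position (i , at)) (suc u) (suc v)
      lift (inj₁ (e₁ , e₂)) = inj₁ (trans (cong vertex (state-at i)) (cong suc e₁) ,
                                    trans (cong vertex (trans (cong next (state-at i)) (next-unmarked i unmarked))) (cong suc e₂))
      lift (inj₂ (e₁ , e₂)) = inj₂ (trans (cong vertex (state-at i)) (cong suc e₁) ,
                                    trans (cong vertex (trans (cong next (state-at i)) (next-unmarked i unmarked))) (cong suc e₂))

    agree : ∀ j j' → j < P → j' < P → Traverses W j (suc u) (suc v) → Traverses W j' (suc u) (suc v) → j ≡ j'
    agree j j' j<P j'<P tj tj' with kept-step j j<P tj | kept-step j' j'<P tj'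
    ... | s , s<L , e , ts | s' , s'<L , e' , ts' =
      trans (time e) (trans (cong (λ z → position (z , at)) (unique-below tour s s' s<L s'<L ts ts')) (sym (time e')))

  same-crossing : ∀ s s' {v} → s < L → s' < L → crossing s ≡ true → crossing s' ≡ true →
                  (ω s ≡ v ⊎ ω (suc s) ≡ v) → (ω s' ≡ v ⊎ ω (suc s') ≡ v) → s ≡ s'
  same-crossing s s' s<L s'<L cs cs' ends ends'
    with cut-same-or-disjoint (crossing-sound s cs) (crossing-sound s' cs')
  ... | inj₁ same = unique-below tour s s' s<L s'<L same (inj₁ (refl , refl))
  ... | inj₂ disj = ⊥-elim (disjoint-share disj ends ends')

  -- step j of W enters x from ω s = v, or leaves x towards ω (suc s) = v
  Half : ℕ → Fin n → ℕ → Set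
  Half j v s = (state j ≡ (s , at) × ω s ≡ v) ⊎ (state j ≡ (s , after) × ω (suc s) ≡ v)

  half-touches : ∀ j {v s} → Half j v s → ω s ≡ v ⊎ ω (suc s) ≡ v
  half-touches j (inj₁ (_ , e)) = inj₁ e
  half-touches j (inj₂ (_ , e)) = inj₂ e

  halves-agree : ∀ j j' {v} s → Half j v s → Half j' v s → j ≡ j'
  halves-agree j j' s (inj₁ (e , _)) (inj₁ (e' , _)) = trans (time e) (sym (time e'))
  halves-agree j j' s (inj₂ (e , _)) (inj₂ (e' , _)) = trans (time e) (sym (time e'))
  halves-agree j j' s (inj₁ (_ , ωs≡v)) (inj₂ (_ , ωs+1≡v)) =
    ⊥-elim (no-loop simple (adjacent s) (trans ωs≡v (sym ωs+1≡v)))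
  halves-agree j j' s (inj₂ (_ , ωs+1≡v)) (inj₁ (_ , ωs≡v)) =
    ⊥-elim (no-loop simple (adjacent s) (trans ωs≡v (sym ωs+1≡v)))

  half-step : ∀ j {v} → j < P → Traverses W j zero (suc v) → ∃[ s ] (s < L × crossing s ≡ true × Half j v s)
  half-step j j<P tr with step-view j | tr
  ... | kept s e e' _ | inj₁ (e₁ , _) = ⊥-elim (suc≢zero (trans (cong vertex (sym e)) e₁))
  ... | kept s e e' _ | inj₂ (_ , e₂) = ⊥-elim (suc≢zero (trans (cong vertex (sym e')) e₂))
  ... | enter s e e' _ | inj₁ (e₁ , _) = ⊥-elim (suc≢zero (trans (cong vertex (sym e)) e₁))
  ... | enter s e e' m | inj₂ (e₁ , _) =
    s , within (s , at) (subst (_< P) (time e) j<P) , m , inj₁ (e , suc-injective (trans (cong vertex (sym e)) e₁))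
  ... | exit s e e' m | inj₁ (_ , e₂) =
    s , within (s , after) (subst (_< P) (time e) j<P) , m , inj₂ (e , suc-injective (trans (cong vertex (sym e')) e₂))
  ... | exit s e e' _ | inj₂ (_ , e₂) = ⊥-elim (suc≢zero (trans (cong vertex (sym e')) e₂))

  once-x : ∀ v → Endpoint v →
           ∃[ i ] (i < P × Traverses W i zero (suc v) × (∀ j → j < P → Traverses W j zero (suc v) → j ≡ i))
  once-x v endpoint = exactly-once P (λ j → Traverses W j zero (suc v)) present agree
    where
    partner : ∃[ p ] Cut v p
    partner = endpoint-cut endpoint

    traversal : ∃[ i ] (i < L × Traverses ω i v (proj₁ partner))
    traversal = first-traversal v (proj₁ partner) (cut-adjacent (proj₂ partner))

    i : ℕ
    i = proj₁ traversal

    i<L : i < L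
    i<L = proj₁ (proj₂ traversal)

    tr : Traverses ω i v (proj₁ partner)
    tr = proj₂ (proj₂ traversal)

    marked : crossing i ≡ true
    marked = isCut-complete _ _ (cut-resp (proj₂ partner) tr)

    at-x : state (position (i , after)) ≡ (i , after)
    at-x = state-position (i , after) marked

    present : ∃[ t ] (t < P × Traverses W t zero (suc v))
    present with tr
    ... | inj₁ (ωi≡v , _) = position (i , at) , at-within i i<L ,
            inj₂ (trans (cong vertex (state-at i)) (cong suc ωi≡v) , cong vertex at-x)
    ... | inj₂ (_ , ωi+1≡v) = position (i , after) , after-within i i<L marked ,
            inj₁ (cong vertex at-x , trans (cong (vertex ∘ next) at-x) (cong suc ωi+1≡v))

    agree : ∀ j j' → j < P → j' < P → Traverses W j zero (suc v) → Traverses W j' zero (suc v) → j ≡ j'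
    agree j j' j<P j'<P tj tj' with half-step j j<P tj | half-step j' j'<P tj'
    ... | s , s<L , cs , h | s' , s'<L , cs' , h'
      with same-crossing s s' s<L s'<L cs cs' (half-touches j h) (half-touches j' h')
    ...   | refl = halves-agree j j' s h h'

  split-once : ∀ u v → Adj Split u v →
               ∃[ i ] (i < P × Traverses W i u v × (∀ j → j < P → Traverses W j u v → j ≡ i))
  split-once zero zero ()
  split-once zero (suc v) xv = once-x v (isABCD-sound v xv)
  split-once (suc u) zero ux =
    let (i , i<P , tr , only) = once-x u (isABCD-sound u ux)
    in i , i<P , traverses-swap {x = W} {i = i} tr ,
       λ j j<P tj → only j j<P (traverses-swap {x = W} {i = j} tj)
  split-once (suc u) (suc v) uv = once-kept u v uv

  circuit : EulerianCircuit Split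
  circuit = record
    { len      = P
    ; walk     = W
    ; periodic = W-periodic
    ; steps    = λ t _ → W-step t
    ; once     = split-once
    }

  x-visit : ∀ t → W t ≡ zero → ∃[ s ] (state t ≡ (s , after) × crossing s ≡ true)
  x-visit t xₜ with state t | proj₂ (position-state t)
  ... | (s , after) | m = s , refl , m
  ... | (s , at) | _ = ⊥-elim (suc≢zero xₜ)

  old-visit : ∀ t → W t ≢ zero → ∃[ s ] state t ≡ (s , at)
  old-visit t ¬xₜ with state t
  ... | (s , at) = s , refl
  ... | (s , after) = ⊥-elim (¬xₜ refl)

  -- visits of x at times t < t' ≤ t + 4 would come from crossing steps
  -- s < s' with s' - s ≤ 3, against the gap lemma
  x-apart : ∀ t t' → t < t' → t' ≤ 4 + t → W t ≡ zero → W t' ≡ zero → ⊥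
  x-apart t t' t<t' t'≤4+t xₜ xₜ' with x-visit t xₜ | x-visit t' xₜ'
  ... | s , e , cs | s' , e' , cs' with s <? s'
  ...   | no s≮s' = <⇒≱ t<t' (subst₂ _≤_ (sym (time e')) (sym (time e))
                                 (s≤s (+-mono-≤ (≮⇒≥ s≮s') (marks-mono (≮⇒≥ s≮s')))))
  ...   | yes s<s' = <⇒≱ (≤-<-trans m≤3 (s≤s (s≤s (s≤s (s≤s z≤n)))))
                         (crossings-far s s' s<s' (≤-<-trans m≤3 period-≥4) cs cs')
    where
    m : ℕ
    m = s' ∸ s
    open ≤-Reasoning
    rearrange : ∀ s c m → suc (s + c) + suc m ≡ suc (s + m + suc c)
    rearrange = solve-∀
    bound : t + suc m ≤ t + 4
    bound = begin
      t + suc m                    ≡⟨ cong (_+ suc m) (time e) ⟩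
      suc (s + marks s) + suc m    ≡⟨ rearrange s (marks s) m ⟩
      suc (s + m + suc (marks s))  ≡⟨ cong (λ z → suc (z + suc (marks s))) (m+[n∸m]≡n (<⇒≤ s<s')) ⟩
      suc (s' + suc (marks s))     ≤⟨ s≤s (+-monoʳ-≤ s' (subst (_≤ marks s') (marks-marked s cs) (marks-mono s<s'))) ⟩
      suc (s' + marks s')          ≡⟨ sym (time e') ⟩
      t'                           ≤⟨ t'≤4+t ⟩
      4 + t                        ≡⟨ +-comm 4 t ⟩
      t + 4                        ∎
    m≤3 : m ≤ 3
    m≤3 = ≤-pred (+-cancelˡ-≤ t (suc m) 4 bound)

  follow : ∀ i s d → state i ≡ (s , at) → (∀ q → 1 ≤ q → q ≤ d → W (i + q) ≢ zero) →
           state (i + d) ≡ (s + d , at)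
  follow i s d e avoid =
    advance i s d e (λ q 1≤q q≤d → cong proj₂ (proj₂ (old-visit (i + q) (avoid q 1≤q q≤d))))

  follow-W : ∀ i s d → state i ≡ (s , at) → (∀ q → 1 ≤ q → q ≤ d → W (i + q) ≢ zero) →
             ∀ r → r ≤ d → W (i + r) ≡ suc (ω (s + r))
  follow-W i s d e avoid r r≤d = cong vertex (follow i s r e (λ q 1≤q q≤r → avoid q 1≤q (≤-trans q≤r r≤d)))

  -- Suppose W is at ω s at time i, visits x at time i + suc p, and avoids
  -- x at all other times in (i , i + suc k'].  Deleting that visit leaves
  -- ω s , … , ω (s + k').
  module SkipOneVisit (i s p k' : ℕ) (e : state i ≡ (s , at)) (p<k' : p < k') (x-at : W (i + suc p) ≡ zero)
                      (avoid : ∀ q → 1 ≤ q → q ≤ suc k' → q ≢ suc p → W (i + q) ≢ zero) where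
    open ≡-Reasoning

    reassoc : ∀ i p d → i + suc (p + d) ≡ i + suc p + d
    reassoc = solve-∀

    avoid-before : ∀ q → 1 ≤ q → q ≤ p → W (i + q) ≢ zero
    avoid-before q 1≤q q≤p = avoid q 1≤q (≤-trans q≤p (≤-trans (n≤1+n p) (<⇒≤ (s≤s p<k'))))
                                   (λ q≡1+p → <-irrefl q≡1+p (s≤s q≤p))

    avoid-after : ∀ q → 1 ≤ q → q ≤ k' ∸ suc p → W (i + suc (suc p) + q) ≢ zero
    avoid-after q 1≤q q≤ = subst (λ z → W z ≢ zero) (reassoc i (suc p) q)
      (avoid (suc (suc p + q)) (s≤s z≤n)
             (s≤s (subst (suc p + q ≤_) (m+[n∸m]≡n p<k') (+-monoʳ-≤ (suc p) q≤)))
             (λ e → <-irrefl (sym e) (s≤s (m≤m+n (suc p) q))))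

    at-p : state (i + p) ≡ (s + p , at)
    at-p = follow i s p e avoid-before

    crossed : crossing (s + p) ≡ true
    crossed with crossing (s + p) in m
    ... | true = refl
    ... | false = ⊥-elim (suc≢zero (trans (cong vertex (sym (trans (cong next at-p) (next-unmarked (s + p) m))))
                                            (trans (cong W (sym (+-suc i p))) x-at)))

    resume : state (i + suc (suc p)) ≡ (s + suc p , at)
    resume = begin
      state (i + suc (suc p))       ≡⟨ cong state (trans (+-suc i (suc p)) (cong suc (+-suc i p))) ⟩
      next (next (state (i + p)))   ≡⟨ cong (next ∘ next) at-p ⟩
      next (next (s + p , at))      ≡⟨ cong next (next-marked (s + p) crossed) ⟩
      (suc (s + p) , at)            ≡⟨ cong (_, at) (sym (+-suc s p)) ⟩
      (s + suc p , at)              ∎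

    by-position : ∀ r → r ≤ k' → Dec (r < suc p) → W (i + skip (suc p) r) ≡ suc (ω (s + r))
    by-position r r≤k' (yes r<1+p) =
      trans (cong (λ z → W (i + z)) (skip-below r<1+p)) (follow-W i s p e avoid-before r (≤-pred r<1+p))
    by-position r r≤k' (no r≮1+p) = begin
      W (i + skip (suc p) r)                 ≡⟨ cong (λ z → W (i + z)) (trans (skip-above r≮1+p) (cong suc (sym split-r))) ⟩
      W (i + suc (suc p + (r ∸ suc p)))      ≡⟨ cong W (reassoc i (suc p) (r ∸ suc p)) ⟩
      W (i + suc (suc p) + (r ∸ suc p))      ≡⟨ follow-W (i + suc (suc p)) (s + suc p) (k' ∸ suc p) resume avoid-after
                                                          (r ∸ suc p) (∸-monoˡ-≤ (suc p) r≤k') ⟩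
      suc (ω (s + suc p + (r ∸ suc p)))      ≡⟨ cong (suc ∘ ω) (trans (+-assoc s (suc p) _) (cong (s +_) split-r)) ⟩
      suc (ω (s + r))                        ∎
      where
      split-r : suc p + (r ∸ suc p) ≡ r
      split-r = m+[n∸m]≡n (≮⇒≥ r≮1+p)

    follow-skipping : ∀ r → r ≤ k' → W (i + skip (suc p) r) ≡ suc (ω (s + r))
    follow-skipping r r≤k' = by-position r r≤k' (r <? suc p)

  x-near : ∀ t t' → t ≢ t' → t ≤ 4 + t' → t' ≤ 4 + t → W t ≡ zero → W t' ≡ zero → ⊥
  x-near t t' t≢t' t≤ t'≤ xₜ xₜ' with <-cmp t t'
  ... | tri< t<t' _ _ = x-apart t t' t<t' t'≤ xₜ xₜ'
  ... | tri≈ _ t≡t' _ = t≢t' t≡t'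
  ... | tri> _ _ t'<t = x-apart t' t t'<t t≤ xₜ' xₜ

  within-4 : ∀ i q r → q ≤ 4 → i + q ≤ 4 + (i + r)
  within-4 i q r q≤4 = ≤-trans (+-monoʳ-≤ i q≤4) (≤-trans (≤-reflexive (+-comm i 4)) (+-monoʳ-≤ 4 (m≤m+n i r)))

  -- W has no subcycle of length at most 4: a subcycle starting at x would
  -- revisit x too soon; otherwise it passes x at most once, and reading it
  -- without x gives a short subcycle of ω
  split-self-avoiding : NoShortSubcycle ω L → ∀ i k → 1 ≤ k → k ≤ 4 → ¬ Subcycle W i k
  split-self-avoiding no-short i (suc k') _ k≤4 (closed , distinct) with W i ≟ zero
  ... | yes xᵢ = x-apart i (i + suc k') (m<m+n i (s≤s z≤n)) (subst (i + suc k' ≤_) (+-comm i 4) (+-monoʳ-≤ i k≤4))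
                         xᵢ (trans (sym closed) xᵢ)
  ... | no ¬xᵢ with old-visit i ¬xᵢ | anyUpTo? (λ p → W (i + p) ≟ zero) (suc k')
  ...   | s , e | no none =
    no-short s (suc k') (s≤s z≤n) k≤4 (≤-trans k≤4 period-≥4)
      (subcycle-transfer W ω id i s (suc k') (suc k') (λ _ _ → id) refl refl (follow-W i s (suc k') e avoid) (closed , distinct))
    where
    avoid : ∀ q → 1 ≤ q → q ≤ suc k' → W (i + q) ≢ zero
    avoid q _ q≤k with m≤n⇒m<n∨m≡n q≤k
    ... | inj₁ q<k = λ x-at → none (q , q<k , x-at)
    ... | inj₂ refl = λ x-at → ¬xᵢ (trans closed x-at)
  ...   | s , e | yes (zero , _ , x₀) = ¬xᵢ (trans (cong W (sym (+-identityʳ i))) x₀)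
  ...   | s , e | yes (suc p , s≤s p<k' , xₚ) =
    no-short s k' (≤-trans (s≤s z≤n) p<k') k'≤4 (≤-trans k'≤4 period-≥4)
      (subcycle-transfer W ω (skip (suc p)) i s (suc k') k' (skip-mono (suc p)) (skip-below {suc p} (s≤s z≤n))
         (skip-above (λ k'<1+p → <⇒≱ p<k' (≤-pred k'<1+p)))
         (SkipOneVisit.follow-skipping i s p k' e p<k' xₚ avoid) (closed , distinct))
    where
    k'≤4 : k' ≤ 4
    k'≤4 = ≤-trans (n≤1+n k') k≤4
    avoid : ∀ q → 1 ≤ q → q ≤ suc k' → q ≢ suc p → W (i + q) ≢ zero
    avoid q _ q≤k q≢1+p x-at =
      x-near (i + q) (i + suc p) (λ e → q≢1+p (+-cancelˡ-≡ i q (suc p) e))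
             (within-4 i q (suc p) (≤-trans q≤k k≤4)) (within-4 i (suc p) q (≤-trans (s≤s (<⇒≤ p<k')) k≤4))
             x-at xₚ

positive-length : ∀ {n} {G : Graph n} (C : EulerianCircuit G) → ∀ {u v} → Adj G u v →
                  ∃[ l ] EulerianCircuit.len C ≡ suc l
positive-length C uv with EulerianCircuit.len C | proj₁ (proj₂ (EulerianCircuit.once C _ _ uv))
... | suc l | _ = l , refl

lemma6 : ∀ {n : ℕ} (G : Graph n) (a b c d : Fin n) →
           IsSimple G → Connected G → Quartic G → PlaneEmbedding G →
           IndependentTwoEdgeCut G a b c d →
           HasLSAEulerianCircuit G →
           HasLSAEulerianCircuit (split G a b c d)
lemma6 G a b c d simple connected quartic _ cut (C , lsa) =
  circuit , λ i k _ k≤4 (1≤k , _ , closed , distinct) →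
              split-self-avoiding no-short i k 1≤k k≤4 (closed , distinct)
  where
  length : ∃[ l ] EulerianCircuit.len C ≡ suc l
  length = positive-length C (IndependentTwoEdgeCut.ab-edge cut)

  open FromCircuit simple C (proj₁ length) (proj₂ length) using (tour; no-short-subcycle)
  open SplitCircuit simple quartic connected cut tour

  no-short : NoShortSubcycle (EulerianCircuit.walk C) (suc (proj₁ length))
  no-short = no-short-subcycle lsa
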